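{- Let $G$ be a finite graph with $\gamma_{1/2}(G)=2$, and let $P_m$ be the path on $m$ vertices ($m\ge 1$). Then $\gamma_{1/2}(G \square P_m) \geq 2\,\gamma_{1/2}(P_m)$.
   Context: For a graph $G=(V,E)$ and a vertex $v$, $N[v]$ denotes the closed neighborhood of $v$, and for $S\subseteq V$, $N[S]=\bigcup_{u\in S}N[u]$. For $p\in[0,1]$, a set $S\subseteq V$ is a $p$-dominating set if $|N[S]|/|V|\geq p$; $\gamma_p(G)$ is the minimum cardinality of a $p$-dominating set of $G$. $G\square H$ denotes the Cartesian product of graphs $G$ and $H$. -}

module Defs where

open import Data.Bool using (Bool; true; false; _∧_; _∨_; not)
open import Data.Nat using (ℕ; zero; suc; _+_; _*_; _≤_; _≥_)
open import Data.Fin using (Fin; toℕ; remQuot)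
open import Data.Fin.Subset using (Subset; ∣_∣; _∈_)
open import Data.Product using (Σ; _×_; _,_; proj₁; proj₂)
open import Data.Vec using (tabulate; lookup)
open import Relation.Binary.PropositionalEquality using (_≡_)

record Graph (n : ℕ) : Set where
  field
    adj    : Fin n → Fin n → Bool
    sym    : ∀ u v → adj u v ≡ adj v u
    irrefl : ∀ v → adj v v ≡ false
open Graph public

eqb : {n : ℕ} → Fin n → Fin n → Bool
eqb {suc n} Fin.zero Fin.zero = true
eqb {suc n} Fin.zero (Fin.suc _) = false
eqb {suc n} (Fin.suc _) Fin.zero = false
eqb {suc n} (Fin.suc i) (Fin.suc j) = eqb i j

Adj : ℕ → Set
Adj n = Fin n → Fin n → Bool

closedAdj : {n : ℕ} → Adj n → Fin n → Fin n → Bool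
closedAdj A u v = eqb u v ∨ A u v

anyFin : {n : ℕ} → (Fin n → Bool) → Bool
anyFin {zero} f = false
anyFin {suc n} f = f Fin.zero ∨ anyFin (λ i → f (Fin.suc i))

closedNbhd : {n : ℕ} → Adj n → Subset n → Subset n
closedNbhd G S = tabulate λ v → anyFin λ u → lookup S u ∧ closedAdj G u v

-- S is a (1/2)-dominating set: |N[S]| / |V| ≥ 1/2, i.e. 2·|N[S]| ≥ |V|
IsHalfDominating : {n : ℕ} → Adj n → Subset n → Set
IsHalfDominating {n} G S = 2 * ∣ closedNbhd G S ∣ ≥ n

IsGammaHalf : {n : ℕ} → Adj n → ℕ → Set
IsGammaHalf {n} G k =
  Σ (Subset n) (λ S → IsHalfDominating G S × ∣ S ∣ ≡ k)
  × (∀ (S : Subset n) → IsHalfDominating G S → k ≤ ∣ S ∣)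

-- the path P_m on vertices 0,…,m-1, with i ~ j iff |i - j| = 1
succb : ℕ → ℕ → Bool
succb zero (suc zero) = true
succb zero _ = false
succb (suc i) zero = false
succb (suc i) (suc j) = succb i j

pathAdj : {m : ℕ} → Fin m → Fin m → Bool
pathAdj i j = succb (toℕ i) (toℕ j) ∨ succb (toℕ j) (toℕ i)

succb-irrefl : ∀ i → succb i i ≡ false
succb-irrefl zero = _≡_.refl
succb-irrefl (suc i) = succb-irrefl i

orComm : ∀ a b → (a ∨ b) ≡ (b ∨ a)
orComm true true = _≡_.refl
orComm true false = _≡_.refl
orComm false true = _≡_.refl
orComm false false = _≡_.refl

Path : (m : ℕ) → Graph m
Path m = record
  { adj = pathAdj
  ; sym = λ u v → orComm (succb (toℕ u) (toℕ v)) (succb (toℕ v) (toℕ u))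
  ; irrefl = λ v → irr (succb-irrefl (toℕ v))
  }
  where
  irr : ∀ {b} → b ≡ false → (b ∨ b) ≡ false
  irr _≡_.refl = _≡_.refl

-- Cartesian product G □ H on Fin (n * m), vertex (g,h) encoded by combine g h:
-- (g,h) ~ (g',h') iff (g = g' and h ~ h') or (h = h' and g ~ g')
cartAdj : {n m : ℕ} → Adj n → Adj m → Adj (n * m)
cartAdj {n} {m} G H x y with remQuot {n} m x | remQuot {n} m y
... | (g , h) | (g' , h') = (eqb g g' ∧ H h h') ∨ (eqb h h' ∧ G g g')

_□P_ : {n : ℕ} → Graph n → (m : ℕ) → Adj (n * m)
G □P m = cartAdj (adj G) (adj (Path m))

{-# OPTIONS --safe #-}
-- Since γ_{1/2}(G) = 2, no single vertex half-dominates G: 2|N_G[g]| < n, and so n ≥ 3.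
-- A vertex (g,h) of G □ P_m satisfies |N[(g,h)]| ≤ |N_G[g]| + deg_P(h), hence
-- 2|N[(g,h)]| ≤ n + 3 ≤ 2n and 2|N[(g,h)]| < nm.  A (1/2)-dominating set S of size k
-- thus gives nm ≤ 2|N[S]| ≤ 2kn, i.e. m ≤ 2k, and likewise nm < knm, i.e. k ≥ 2.
-- Finally the ⌊k/2⌋ vertices of P_m at odd positions below k dominate its first
-- min(m,k) ≥ m/2 vertices, so 2γ_{1/2}(P_m) ≤ k.
module Submission where

open import Defs hiding (sym)
open import Data.Bool using (Bool; true; false; T; _∧_; _∨_)
open import Data.Bool.Properties using (T-∧; T-∨)
open import Data.Fin using (Fin; zero; suc; toℕ; inject₁; splitAt; quotRem; quotient; remainder)
open import Data.Fin.Properties using (toℕ-injective; toℕ-inject₁)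
import Data.Fin.Properties as Finₚ
open import Data.Fin.Subset using (Subset; ∣_∣; ⁅_⁆; ⊥)
open import Data.Fin.Subset.Properties using (∣⁅x⁆∣≡1; x∈⁅x⁆)
open import Data.Nat using (ℕ; zero; suc; pred; _+_; _*_; _≤_; _≥_; _<_; _⊓_; _<ᵇ_; z≤n; s≤s; >-nonZero)
open import Data.Nat.Properties
open import Algebra.Properties.CommutativeSemigroup +-commutativeSemigroup
  using () renaming (interchange to +-interchange)
open import Data.Nat.Tactic.RingSolver using (solve-∀)
open import Data.Product using (∃; _×_; _,_; proj₁; proj₂; swap; map₂)
open import Data.Sum using (_⊎_; inj₁; inj₂; map₁; [_,_]′)
open import Data.Vec using (tabulate; lookup)
open import Data.Vec.Properties using (lookup∘tabulate; tabulate∘lookup; []=⇒lookup)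
open import Function using (_∘_; Equivalence)
open import Relation.Binary.PropositionalEquality
open import Relation.Nullary using (¬_; contradiction)

open Equivalence

boolToℕ : Bool → ℕ
boolToℕ true  = 1
boolToℕ false = 0

boolToℕ-mono : ∀ {a b} → (T a → T b) → boolToℕ a ≤ boolToℕ b
boolToℕ-mono {false}         _   = z≤n
boolToℕ-mono {true}  {true}  _   = ≤-refl
boolToℕ-mono {true}  {false} a⇒b = contradiction _ a⇒b

boolToℕ≤1 : ∀ b → boolToℕ b ≤ 1
boolToℕ≤1 true  = ≤-refl
boolToℕ≤1 false = z≤n

boolToℕ-∨ : ∀ a b → boolToℕ (a ∨ b) ≤ boolToℕ a + boolToℕ b
boolToℕ-∨ true  _ = s≤s z≤n
boolToℕ-∨ false _ = ≤-refl

count : ∀ {n} → (Fin n → Bool) → ℕ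
count {zero}  f = 0
count {suc n} f = boolToℕ (f zero) + count (f ∘ suc)

∣tabulate∣≡count : ∀ {n} (f : Fin n → Bool) → ∣ tabulate f ∣ ≡ count f
∣tabulate∣≡count {zero}  f = refl
∣tabulate∣≡count {suc n} f with f zero
... | true  = cong suc (∣tabulate∣≡count (f ∘ suc))
... | false = ∣tabulate∣≡count (f ∘ suc)

∣p∣≡count∘lookup : ∀ {n} (p : Subset n) → ∣ p ∣ ≡ count (lookup p)
∣p∣≡count∘lookup p = trans (cong ∣_∣ (sym (tabulate∘lookup p))) (∣tabulate∣≡count (lookup p))

count-false : ∀ {n} → count {n} (λ _ → false) ≡ 0
count-false {zero}  = refl
count-false {suc n} = count-false {n}

count-mono : ∀ {n} {f g : Fin n → Bool} → (∀ i → T (f i) → T (g i)) → count f ≤ count g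
count-mono {zero}  _   = z≤n
count-mono {suc n} f⇒g = +-mono-≤ (boolToℕ-mono (f⇒g zero)) (count-mono (f⇒g ∘ suc))

count≤n : ∀ {n} (f : Fin n → Bool) → count f ≤ n
count≤n {zero}  f = z≤n
count≤n {suc n} f = +-mono-≤ (boolToℕ≤1 (f zero)) (count≤n (f ∘ suc))

count<n : ∀ {n} (f : Fin n → Bool) i → ¬ T (f i) → count f < n
count<n f zero    ¬fi = s≤s (+-mono-≤ (boolToℕ-mono ¬fi) (count≤n (f ∘ suc)))
count<n f (suc i) ¬fi = begin-strict
  boolToℕ (f zero) + count (f ∘ suc) <⟨ +-monoʳ-< (boolToℕ (f zero)) (count<n (f ∘ suc) i ¬fi) ⟩
  boolToℕ (f zero) + _               ≤⟨ +-monoˡ-≤ _ (boolToℕ≤1 (f zero)) ⟩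
  suc _                              ∎
  where open ≤-Reasoning

count-pos : ∀ {n} (f : Fin n → Bool) i → T (f i) → 1 ≤ count f
count-pos f zero    fi = ≤-trans (boolToℕ-mono {true} (λ _ → fi)) (m≤m+n _ _)
count-pos f (suc i) fi = ≤-trans (count-pos (f ∘ suc) i fi) (m≤n+m _ _)

count≤1 : ∀ {n} (f : Fin n → Bool) → (∀ {i j} → T (f i) → T (f j) → i ≡ j) → count f ≤ 1
count≤1 {zero}  f _      = z≤n
count≤1 {suc n} f unique =
  head (f zero) onlyZero (count≤1 (f ∘ suc) (λ fi fj → Finₚ.suc-injective (unique fi fj)))
  where
  onlyZero : T (f zero) → count (f ∘ suc) ≡ 0
  onlyZero f0 = n≤0⇒n≡0 (begin
    count (f ∘ suc)         ≤⟨ count-mono {n} {f ∘ suc} {λ _ → false} (λ i fi → Finₚ.0≢1+n (unique f0 fi)) ⟩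
    count {n} (λ _ → false) ≡⟨ count-false {n} ⟩
    0                       ∎)
    where open ≤-Reasoning
  head : ∀ b → (T b → count (f ∘ suc) ≡ 0) → count (f ∘ suc) ≤ 1 → boolToℕ b + count (f ∘ suc) ≤ 1
  head true  none _   = ≤-reflexive (cong suc (none _))
  head false _    c≤1 = c≤1

count-∨ : ∀ {n} (f g : Fin n → Bool) → count (λ i → f i ∨ g i) ≤ count f + count g
count-∨ {zero}  f g = z≤n
count-∨ {suc n} f g = begin
  boolToℕ (f zero ∨ g zero) + count (λ i → f (suc i) ∨ g (suc i))
    ≤⟨ +-mono-≤ (boolToℕ-∨ (f zero) (g zero)) (count-∨ (f ∘ suc) (g ∘ suc)) ⟩
  (boolToℕ (f zero) + boolToℕ (g zero)) + (count (f ∘ suc) + count (g ∘ suc))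
    ≡⟨ +-interchange (boolToℕ (f zero)) _ _ _ ⟩
  count f + count g ∎
  where open ≤-Reasoning

count-∧ˡ : ∀ {n} b (f : Fin n → Bool) → count (λ i → b ∧ f i) ≡ boolToℕ b * count f
count-∧ˡ true  f = sym (+-identityʳ (count f))
count-∧ˡ {n} false f = count-false {n}

count-splitAt : ∀ a {b} (F : Fin a ⊎ Fin b → Bool) →
  count (F ∘ splitAt a) ≡ count (F ∘ inj₁) + count (F ∘ inj₂)
count-splitAt zero    F = refl
count-splitAt (suc a) F = begin
  boolToℕ (F (inj₁ zero)) + count (F ∘ map₁ suc ∘ splitAt a)
    ≡⟨ cong (boolToℕ (F (inj₁ zero)) +_) (count-splitAt a (F ∘ map₁ suc)) ⟩
  boolToℕ (F (inj₁ zero)) + (count (F ∘ inj₁ ∘ suc) + count (F ∘ inj₂))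
    ≡⟨ sym (+-assoc (boolToℕ (F (inj₁ zero))) _ _) ⟩
  count (F ∘ inj₁) + count (F ∘ inj₂) ∎
  where open ≡-Reasoning

count-remQuot : ∀ n {m} (P : Fin n → Bool) (Q : Fin m → Bool) →
  count {n * m} (λ x → P (quotient {n} m x) ∧ Q (remainder {n} m x)) ≡ count P * count Q
count-remQuot zero    P Q = refl
count-remQuot (suc n) {m} P Q = begin
  count {m + n * m} (λ x → P (quotient {suc n} m x) ∧ Q (remainder {suc n} m x))
    ≡⟨ count-splitAt m (λ s → P (proj₁ (cell s)) ∧ Q (proj₂ (cell s))) ⟩
  count (λ h → P zero ∧ Q h) + count (λ x → P (suc (quotient {n} m x)) ∧ Q (remainder {n} m x))
    ≡⟨ cong₂ _+_ (count-∧ˡ (P zero) Q) (count-remQuot n (P ∘ suc) Q) ⟩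
  boolToℕ (P zero) * count Q + count (P ∘ suc) * count Q
    ≡⟨ sym (*-distribʳ-+ (count Q) (boolToℕ (P zero)) _) ⟩
  count P * count Q ∎
  where
  open ≡-Reasoning
  -- remQuot {suc n} m unfolds definitionally to cell ∘ splitAt m.
  cell : Fin m ⊎ Fin (n * m) → Fin (suc n) × Fin m
  cell = swap ∘ [ (_, zero) , map₂ suc ∘ quotRem {n} m ]′

anyFin-intro : ∀ {n} (f : Fin n → Bool) i → T (f i) → T (anyFin f)
anyFin-intro f zero    fi = from T-∨ (inj₁ fi)
anyFin-intro f (suc i) fi = from T-∨ (inj₂ (anyFin-intro (f ∘ suc) i fi))

count-anyFin-∧ : ∀ {n N} (s : Fin n → Bool) (R : Fin n → Fin N → Bool) {a B} →
  (∀ u → a * count (R u) ≤ B) →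
  a * count (λ v → anyFin (λ u → s u ∧ R u v)) ≤ count s * B
count-anyFin-∧ {zero} {N} s R {a} _ = ≤-reflexive (trans (cong (a *_) (count-false {N})) (*-zeroʳ a))
count-anyFin-∧ {suc n} {N} s R {a} {B} bound = begin
  a * count (λ v → (s zero ∧ R zero v) ∨ rest v)
    ≤⟨ *-monoʳ-≤ a (count-∨ (λ v → s zero ∧ R zero v) rest) ⟩
  a * (count (λ v → s zero ∧ R zero v) + count rest)
    ≡⟨ *-distribˡ-+ a _ _ ⟩
  a * count (λ v → s zero ∧ R zero v) + a * count rest
    ≤⟨ +-mono-≤ (head (s zero)) (count-anyFin-∧ (s ∘ suc) (R ∘ suc) {a} (bound ∘ suc)) ⟩
  boolToℕ (s zero) * B + count (s ∘ suc) * B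
    ≡⟨ sym (*-distribʳ-+ B (boolToℕ (s zero)) _) ⟩
  count s * B ∎
  where
  open ≤-Reasoning
  rest : Fin N → Bool
  rest v = anyFin (λ u → s (suc u) ∧ R (suc u) v)
  head : ∀ b → a * count (λ v → b ∧ R zero v) ≤ boolToℕ b * B
  head true  = ≤-trans (bound zero) (≤-reflexive (sym (+-identityʳ B)))
  head false = ≤-reflexive (trans (cong (a *_) (count-false {N})) (*-zeroʳ a))

eqb-refl : ∀ {n} (i : Fin n) → T (eqb i i)
eqb-refl zero    = _
eqb-refl (suc i) = eqb-refl i

eqb⇒≡ : ∀ {n} {i j : Fin n} → T (eqb i j) → i ≡ j
eqb⇒≡ {i = zero}  {zero}  _ = refl
eqb⇒≡ {i = suc i} {suc j} e = cong suc (eqb⇒≡ e)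

count-eqb : ∀ {n} (i : Fin n) → count (eqb i) ≡ 1
count-eqb {suc n} zero    = cong suc (count-false {n})
count-eqb {suc n} (suc i) = count-eqb i

closedAdj-refl : ∀ {n} (A : Adj n) x → T (closedAdj A x x)
closedAdj-refl A x = from T-∨ (inj₁ (eqb-refl x))

adj⇒closedAdj : ∀ {n} (A : Adj n) {x y} → T (A x y) → T (closedAdj A x y)
adj⇒closedAdj A = from T-∨ ∘ inj₂

degree : ∀ {n} → Adj n → Fin n → ℕ
degree A x = count (A x)

closedDegree : ∀ {n} → Adj n → Fin n → ℕ
closedDegree A x = count (closedAdj A x)

closedDegree≥1 : ∀ {n} (A : Adj n) x → 1 ≤ closedDegree A x
closedDegree≥1 A x = count-pos (closedAdj A x) x (closedAdj-refl A x)

degree<n : ∀ {n} (G : Graph n) v → degree (adj G) v < n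
degree<n G v = count<n (adj G v) v (subst T (irrefl G v))

closedDegree≤∣closedNbhd∣ : ∀ {n} (A : Adj n) (S : Subset n) x → T (lookup S x) →
  closedDegree A x ≤ ∣ closedNbhd A S ∣
closedDegree≤∣closedNbhd∣ A S x x∈S = begin
  closedDegree A x
    ≤⟨ count-mono (λ v xv → anyFin-intro (λ u → lookup S u ∧ closedAdj A u v) x (from T-∧ (x∈S , xv))) ⟩
  count (λ v → anyFin (λ u → lookup S u ∧ closedAdj A u v))
    ≡⟨ sym (∣tabulate∣≡count (λ v → anyFin (λ u → lookup S u ∧ closedAdj A u v))) ⟩
  ∣ closedNbhd A S ∣ ∎
  where open ≤-Reasoning

∣closedNbhd∣-bound : ∀ {n} (A : Adj n) (S : Subset n) {a B} →
  (∀ x → a * closedDegree A x ≤ B) → a * ∣ closedNbhd A S ∣ ≤ ∣ S ∣ * B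
∣closedNbhd∣-bound A S {a} {B} bound = begin
  a * ∣ closedNbhd A S ∣
    ≡⟨ cong (a *_) (∣tabulate∣≡count (λ v → anyFin (λ u → lookup S u ∧ closedAdj A u v))) ⟩
  a * count (λ v → anyFin (λ u → lookup S u ∧ closedAdj A u v))
    ≤⟨ count-anyFin-∧ (lookup S) (closedAdj A) {a} bound ⟩
  count (lookup S) * B
    ≡⟨ cong (_* B) (sym (∣p∣≡count∘lookup S)) ⟩
  ∣ S ∣ * B ∎
  where open ≤-Reasoning

γ≥2⇒2*closedDegree<n : ∀ {n} (A : Adj n) → (∀ S → IsHalfDominating A S → 2 ≤ ∣ S ∣) →
  ∀ x → 2 * closedDegree A x < n
γ≥2⇒2*closedDegree<n A minimal x = ≰⇒> λ n≤2d → <-irrefl refl (begin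
  2          ≤⟨ minimal ⁅ x ⁆ (≤-trans n≤2d (*-monoʳ-≤ 2 (closedDegree≤∣closedNbhd∣ A ⁅ x ⁆ x x∈ᵇ⁅x⁆))) ⟩
  ∣ ⁅ x ⁆ ∣  ≡⟨ ∣⁅x⁆∣≡1 x ⟩
  1          ∎)
  where
  open ≤-Reasoning
  x∈ᵇ⁅x⁆ : T (lookup ⁅ x ⁆ x)
  x∈ᵇ⁅x⁆ = subst T (sym ([]=⇒lookup (x∈⁅x⁆ x))) _

γ≥2⇒3≤n : ∀ {n} (A : Adj n) → (∀ S → IsHalfDominating A S → 2 ≤ ∣ S ∣) → 3 ≤ n
γ≥2⇒3≤n {zero}  A minimal = contradiction (minimal ⊥ z≤n) λ ()
γ≥2⇒3≤n {suc n} A minimal =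
  ≤-trans (s≤s (*-monoʳ-≤ 2 (closedDegree≥1 A zero))) (γ≥2⇒2*closedDegree<n A minimal zero)

closedAdj-cart⇒ : ∀ {n m} (A : Adj n) (B : Adj m) (x y : Fin (n * m)) →
  T (closedAdj (cartAdj A B) x y) →
  T (closedAdj A (quotient {n} m x) (quotient {n} m y) ∧ eqb (remainder {n} m x) (remainder {n} m y)) ⊎
  T (eqb (quotient {n} m x) (quotient {n} m y) ∧ B (remainder {n} m x) (remainder {n} m y))
closedAdj-cart⇒ {n} {m} A B x y xy with to T-∨ xy
... | inj₁ x=y rewrite eqb⇒≡ {i = x} {y} x=y =
  inj₁ (from T-∧ (closedAdj-refl A (quotient {n} m y) , eqb-refl (remainder {n} m y)))
... | inj₂ xy′ with to T-∨ xy′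
...   | inj₁ g=g′∧h~h′ = inj₂ g=g′∧h~h′
...   | inj₂ h=h′∧g~g′ with to T-∧ h=h′∧g~g′
...     | h=h′ , g~g′ = inj₁ (from T-∧ (adj⇒closedAdj A g~g′ , h=h′))

closedDegree-cart≤ : ∀ {n m} (A : Adj n) (B : Adj m) (x : Fin (n * m)) →
  closedDegree (cartAdj A B) x ≤ closedDegree A (quotient {n} m x) + degree B (remainder {n} m x)
closedDegree-cart≤ {n} {m} A B x = begin
  closedDegree (cartAdj A B) x
    ≤⟨ count-mono (λ y → from T-∨ ∘ closedAdj-cart⇒ A B x y) ⟩
  count (λ y → alongG y ∨ alongP y)
    ≤⟨ count-∨ alongG alongP ⟩
  count alongG + count alongP
    ≡⟨ cong₂ _+_ (count-remQuot n (closedAdj A g) (eqb h)) (count-remQuot n (eqb g) (B h)) ⟩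
  closedDegree A g * count (eqb h) + count (eqb g) * degree B h
    ≡⟨ cong₂ _+_ (trans (cong (closedDegree A g *_) (count-eqb h)) (*-identityʳ _))
                 (trans (cong (_* degree B h) (count-eqb g)) (*-identityˡ _)) ⟩
  closedDegree A g + degree B h ∎
  where
  open ≤-Reasoning
  g = quotient {n} m x
  h = remainder {n} m x
  alongG alongP : Fin (n * m) → Bool
  alongG y = closedAdj A g (quotient {n} m y) ∧ eqb h (remainder {n} m y)
  alongP y = eqb g (quotient {n} m y) ∧ B h (remainder {n} m y)

succb-suc : ∀ i → T (succb i (suc i))
succb-suc zero    = _
succb-suc (suc i) = succb-suc i

succb⇒≡suc : ∀ {i j} → T (succb i j) → j ≡ suc i
succb⇒≡suc {zero}  {suc zero} _ = refl
succb⇒≡suc {suc i} {suc j}    p = cong suc (succb⇒≡suc p)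

pathAdj-suc : ∀ {m} {u v : Fin m} → toℕ v ≡ suc (toℕ u) → T (pathAdj u v)
pathAdj-suc {u = u} v=u+1 rewrite v=u+1 = from T-∨ (inj₁ (succb-suc (toℕ u)))

degree-Path≤2 : ∀ {m} (h : Fin m) → degree pathAdj h ≤ 2
degree-Path≤2 {m} h = ≤-trans (count-∨ right left) (+-mono-≤ (count≤1 right right-unique) (count≤1 left left-unique))
  where
  right left : Fin m → Bool
  right v = succb (toℕ h) (toℕ v)
  left  v = succb (toℕ v) (toℕ h)
  right-unique : ∀ {u v : Fin m} → T (succb (toℕ h) (toℕ u)) → T (succb (toℕ h) (toℕ v)) → u ≡ v
  right-unique p q = toℕ-injective (trans (succb⇒≡suc {toℕ h} p) (sym (succb⇒≡suc {toℕ h} q)))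
  left-unique : ∀ {u v : Fin m} → T (succb (toℕ u) (toℕ h)) → T (succb (toℕ v) (toℕ h)) → u ≡ v
  left-unique p q = toℕ-injective (suc-injective (trans (sym (succb⇒≡suc {j = toℕ h} p)) (succb⇒≡suc {j = toℕ h} q)))

oddBelow : ℕ → ℕ → Bool
oddBelow k             zero          = false
oddBelow (suc (suc k)) (suc zero)    = true
oddBelow (suc (suc k)) (suc (suc i)) = oddBelow k i
oddBelow _             (suc _)       = false

oddBelow-near : ∀ k i → suc i < k → T (oddBelow k i) ⊎ T (oddBelow k (suc i))
oddBelow-near (suc (suc k))       zero          _                 = inj₂ _
oddBelow-near (suc (suc (suc k))) (suc zero)    _                 = inj₁ _
oddBelow-near (suc (suc k))       (suc (suc i)) (s≤s (s≤s i+1<k)) = oddBelow-near k i i+1<k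
oddBelow-near (suc zero)          _             (s≤s ())
oddBelow-near (suc (suc zero))    (suc zero)    (s≤s (s≤s ()))

2*count-oddBelow≤ : ∀ m k → 2 * count {m} (oddBelow k ∘ toℕ) ≤ k
2*count-oddBelow≤ zero                k             = z≤n
2*count-oddBelow≤ (suc zero)          k             = z≤n
2*count-oddBelow≤ (suc (suc m))       zero          = ≤-reflexive (cong (2 *_) (count-false {m}))
2*count-oddBelow≤ (suc (suc m))       (suc zero)    = ≤-trans (≤-reflexive (cong (2 *_) (count-false {m}))) z≤n
2*count-oddBelow≤ (suc (suc m))       (suc (suc k)) =
  subst (_≤ suc (suc k)) (sym (*-suc 2 (count {m} (oddBelow k ∘ toℕ)))) (s≤s (s≤s (2*count-oddBelow≤ m k)))

count-toℕ<ᵇ : ∀ m k → count {m} (λ v → toℕ v <ᵇ k) ≡ m ⊓ k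
count-toℕ<ᵇ zero    k       = refl
count-toℕ<ᵇ (suc m) zero    = count-false {m}
count-toℕ<ᵇ (suc m) (suc k) = cong suc (count-toℕ<ᵇ m k)

oddBelow-covers : ∀ {m} k (v : Fin (suc (suc m))) → 2 ≤ k → toℕ v < k →
  ∃ λ u → T (oddBelow k (toℕ u)) × T (closedAdj pathAdj u v)
oddBelow-covers (suc (suc k)) zero    _ _   = suc zero , _ , _
oddBelow-covers (suc zero)    zero    (s≤s ()) _
oddBelow-covers k             (suc v) _ v<k with oddBelow-near k (toℕ v) v<k
... | inj₁ odd = inject₁ v , subst (T ∘ oddBelow k) (sym (toℕ-inject₁ v)) odd
                           , adj⇒closedAdj pathAdj {inject₁ v} {suc v} (pathAdj-suc (cong suc (sym (toℕ-inject₁ v))))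
... | inj₂ odd = suc v , odd , closedAdj-refl pathAdj (suc v)

oddBelow-halfDominating : ∀ {m k} → 2 ≤ k → suc (suc m) ≤ 2 * k →
  IsHalfDominating (adj (Path (suc (suc m)))) (tabulate (oddBelow k ∘ toℕ))
oddBelow-halfDominating {m} {k} 2≤k M≤2k = begin
  M                                ≤⟨ ⊓-glb (m≤m+n M (M + 0)) M≤2k ⟩
  (2 * M) ⊓ (2 * k)                ≡⟨ sym (*-distribˡ-⊓ 2 M k) ⟩
  2 * (M ⊓ k)                      ≡⟨ cong (2 *_) (sym (count-toℕ<ᵇ M k)) ⟩
  2 * count {M} (λ v → toℕ v <ᵇ k) ≤⟨ *-monoʳ-≤ 2 (count-mono covered) ⟩
  2 * count dominated              ≡⟨ cong (2 *_) (sym (∣tabulate∣≡count dominated)) ⟩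
  2 * ∣ closedNbhd pathAdj D ∣      ∎
  where
  open ≤-Reasoning
  M = suc (suc m)
  D : Subset M
  D = tabulate (oddBelow k ∘ toℕ)
  dominated : Fin M → Bool
  dominated v = anyFin (λ u → lookup D u ∧ closedAdj pathAdj u v)
  covered : ∀ v → T (toℕ v <ᵇ k) → T (dominated v)
  covered v v<k with oddBelow-covers k v 2≤k (<ᵇ⇒< (toℕ v) k v<k)
  ... | u , odd , uv = anyFin-intro (λ u → lookup D u ∧ closedAdj pathAdj u v) u
                         (from T-∧ (subst T (sym (lookup∘tabulate (oddBelow k ∘ toℕ) u)) odd , uv))

2*γ-Path≤ : ∀ {m k l} → 2 ≤ k → m ≤ 2 * k → IsGammaHalf (adj (Path m)) l → 2 * l ≤ k
2*γ-Path≤ {zero}          2≤k _    (_ , minimal) = ≤-trans (*-monoʳ-≤ 2 (minimal ⊥ z≤n)) z≤n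
2*γ-Path≤ {suc zero}      2≤k _    (_ , minimal) = ≤-trans (*-monoʳ-≤ 2 (minimal ⁅ zero ⁆ (s≤s z≤n))) 2≤k
2*γ-Path≤ {suc (suc m)} {k} {l} 2≤k m≤2k (_ , minimal) = begin
  2 * l                                 ≤⟨ *-monoʳ-≤ 2 (minimal D (oddBelow-halfDominating 2≤k m≤2k)) ⟩
  2 * ∣ D ∣                             ≡⟨ cong (2 *_) (∣tabulate∣≡count {suc (suc m)} (oddBelow k ∘ toℕ)) ⟩
  2 * count {suc (suc m)} (oddBelow k ∘ toℕ) ≤⟨ 2*count-oddBelow≤ (suc (suc m)) k ⟩
  k                                     ∎
  where
  open ≤-Reasoning
  D : Subset (suc (suc m))
  D = tabulate (oddBelow k ∘ toℕ)

2*[c+d]≤n+3 : ∀ {c d n} → 2 * c < n → d ≤ 2 → 2 * (c + d) ≤ n + 3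
2*[c+d]≤n+3 {c} {d} {n} 2c<n d≤2 = ≤-pred (begin
  suc (2 * (c + d))    ≡⟨ cong suc (*-distribˡ-+ 2 c d) ⟩
  suc (2 * c) + 2 * d  ≤⟨ +-mono-≤ 2c<n (*-monoʳ-≤ 2 d≤2) ⟩
  n + 4                ≡⟨ +-suc n 3 ⟩
  suc (n + 3)          ∎)
  where open ≤-Reasoning

2*[c+d]<n*m : ∀ {c d n m} → 2 ≤ n → 2 * c < n → d < m → 2 * (c + d) < n * m
2*[c+d]<n*m {c} {d} {n} {m} 2≤n 2c<n d<m = begin-strict
  2 * (c + d)    ≡⟨ *-distribˡ-+ 2 c d ⟩
  2 * c + 2 * d  <⟨ +-monoˡ-< (2 * d) 2c<n ⟩
  n + 2 * d      ≤⟨ +-monoʳ-≤ n (*-monoˡ-≤ d 2≤n) ⟩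
  n + n * d      ≡⟨ sym (*-suc n d) ⟩
  n * suc d      ≤⟨ *-monoʳ-≤ n d<m ⟩
  n * m          ∎
  where open ≤-Reasoning

n*m≤k*[n+3]⇒m≤2*k : ∀ {n m k} → 3 ≤ n → n * m ≤ k * (n + 3) → m ≤ 2 * k
n*m≤k*[n+3]⇒m≤2*k {n} {m} {k} 3≤n nm≤ = *-cancelˡ-≤ n {{>-nonZero (≤-trans (s≤s z≤n) 3≤n)}} (begin
  n * m        ≤⟨ nm≤ ⟩
  k * (n + 3)  ≤⟨ *-monoʳ-≤ k (+-monoʳ-≤ n 3≤n) ⟩
  k * (n + n)  ≡⟨ k*[n+n]≡n*[2*k] k n ⟩
  n * (2 * k)  ∎)
  where
  open ≤-Reasoning
  k*[n+n]≡n*[2*k] : ∀ k n → k * (n + n) ≡ n * (2 * k)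
  k*[n+n]≡n*[2*k] = solve-∀

N≤k*pred[N]⇒2≤k : ∀ {N} k → 1 ≤ N → N ≤ k * pred N → 2 ≤ k
N≤k*pred[N]⇒2≤k {suc N} zero          _ ()
N≤k*pred[N]⇒2≤k {suc N} (suc zero)    _ N+1≤N+0 = contradiction (subst (suc N ≤_) (+-identityʳ N) N+1≤N+0) (n≮n N)
N≤k*pred[N]⇒2≤k {suc N} (suc (suc k)) _ _       = s≤s (s≤s z≤n)

module _ {n} (G : Graph n) (m : ℕ) (minimal : ∀ S → IsHalfDominating (adj G) S → 2 ≤ ∣ S ∣) where

  private
    c d : Fin (n * m) → ℕ
    c x = closedDegree (adj G) (quotient {n} m x)
    d x = degree pathAdj (remainder {n} m x)

    2c<n : ∀ x → 2 * c x < n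
    2c<n x = γ≥2⇒2*closedDegree<n (adj G) minimal (quotient {n} m x)

    2*closedDegree≤ : ∀ x → 2 * closedDegree (G □P m) x ≤ 2 * (c x + d x)
    2*closedDegree≤ x = *-monoʳ-≤ 2 (closedDegree-cart≤ (adj G) pathAdj x)

  2*closedDegree-□P≤n+3 : ∀ x → 2 * closedDegree (G □P m) x ≤ n + 3
  2*closedDegree-□P≤n+3 x =
    ≤-trans (2*closedDegree≤ x) (2*[c+d]≤n+3 {c x} {d x} (2c<n x) (degree-Path≤2 (remainder {n} m x)))

  2*closedDegree-□P<n*m : ∀ x → 2 * closedDegree (G □P m) x < n * m
  2*closedDegree-□P<n*m x = ≤-<-trans (2*closedDegree≤ x)
    (2*[c+d]<n*m {c x} {d x} (≤-trans (s≤s (s≤s z≤n)) (γ≥2⇒3≤n (adj G) minimal)) (2c<n x)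
                 (degree<n (Path m) (remainder {n} m x)))

mainTheorem6 : {n : ℕ} (G : Graph n) (m : ℕ) → m ≥ 1 →
    IsGammaHalf (adj G) 2 →
    (k l : ℕ) → IsGammaHalf (G □P m) k → IsGammaHalf (adj (Path m)) l →
    k ≥ 2 * l
mainTheorem6 {n} G m m≥1 (_ , minimal) k l ((S , S-dom , ∣S∣≡k) , _) γP = 2*γ-Path≤ 2≤k m≤2k γP
  where
  3≤n : 3 ≤ n
  3≤n = γ≥2⇒3≤n (adj G) minimal
  n*m≤k*B : ∀ {B} → (∀ x → 2 * closedDegree (G □P m) x ≤ B) → n * m ≤ k * B
  n*m≤k*B {B} bound = subst (λ s → n * m ≤ s * B) ∣S∣≡k (≤-trans S-dom (∣closedNbhd∣-bound (G □P m) S {2} bound))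
  m≤2k : m ≤ 2 * k
  m≤2k = n*m≤k*[n+3]⇒m≤2*k {k = k} 3≤n (n*m≤k*B (2*closedDegree-□P≤n+3 G m minimal))
  2≤k : 2 ≤ k
  2≤k = N≤k*pred[N]⇒2≤k k (*-mono-≤ (≤-trans (s≤s z≤n) 3≤n) m≥1)
          (n*m≤k*B (<⇒≤pred ∘ 2*closedDegree-□P<n*m G m minimal))
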